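{- For every $n\in\mathbb N$, the formula $\mathrm{KBKF}_n$ can be refuted in the calculus Q-Res+S by no more than $5n$ applications of the rules S, R, U.
   Context: A QBF is $P.\phi$ with $\phi$ a CNF (clauses viewed as sets of literals $x$, $\bar x$) and $P=Q_1x_1\cdots Q_mx_m$ with $Q_i\in\{\forall,\exists\}$; $x_i<_P x_j$ iff $i<j$. The calculus Q-Res+S has rules: (A) any clause of $\phi$ may be derived (not counted as a step); (R) from derived clauses $C\lor x$ and $C'\lor\bar x$, with $x$ existential and $C\cup C'$ not a tautology, derive $C\lor C'$; (U) from a derived clause $C\lor l$ with $l$ a universal literal, $\bar l\notin C$, and every existential literal $k\in C$ satisfying $k<_P l$, derive $C$; (S) from a derived clause $C$ and a symmetry $\sigma$ of $P.\phi$, derive $\sigma(C)$. A bijection $\sigma$ of the literal set is admissible for $P$ if $\overline{\sigma(x)}=\sigma(\bar x)$ for every variable $x$ and $\sigma$ maps a variable $x_i$ to $x_j$ or $\bar x_j$ only if $x_i,x_j$ lie in the same quantifier block; an admissible $\sigma$ is a symmetry of $P.\phi$ if applying it to all literals of $\phi$ maps $\phi$ to itself up to reordering clauses and literals. A refutation derives the empty clause. $\mathrm{KBKF}_n$ has prefix $\exists x_1y_1\forall a_1\exists x_2y_2\forall a_2\dots\exists x_ny_n\forall a_n\exists z_1\dots z_n$ and clauses: $C_1=(\bar x_1\lor\bar y_1)$; for $j=1,\dots,n-1$: $C_{2j}=(x_j\lor\bar a_j\lor\bar x_{j+1}\lor\bar y_{j+1})$ and $C_{2j+1}=(y_j\lor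 a_j\lor\bar x_{j+1}\lor\bar y_{j+1})$; $C_{2n}=(x_n\lor\bar a_n\lor\bar z_1\lor\dots\lor\bar z_n)$, $C_{2n+1}=(y_n\lor a_n\lor\bar z_1\lor\dots\lor\bar z_n)$; for $j=1,\dots,n$: $B_{2j-1}=(a_j\lor z_j)$ and $B_{2j}=(\bar a_j\lor z_j)$. -}

module Defs where

open import Data.Nat using (ℕ; zero; suc; _+_; _*_; _<_; _<ᵇ_; _%_)
open import Data.Bool using (Bool; true; false; not; if_then_else_)
open import Data.Fin using (Fin; toℕ; inject₁; combine; _↑ˡ_; _↑ʳ_) renaming (suc to fsuc; zero to fzero)
open import Data.List using (List; []; _∷_; map; concat; _++_; allFin)
open import Data.List.Membership.Propositional using (_∈_; _∉_)
open import Data.Product using (Σ; ∃; _×_; _,_)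
open import Data.Sum using (_⊎_)
open import Relation.Binary.PropositionalEquality using (_≡_; _≢_)
open import Relation.Nullary using (¬_)
open import Function.Bundles using (_⇔_)
open import Function.Definitions using (Bijective)

-- QBFs.  Variables are x_0 .. x_{m-1} (type Fin m); the prefix is
-- Q_0 x_0 ... Q_{m-1} x_{m-1}, so x_i <_P x_j iff i < j (as Fin).

data Quant : Set where
  ∀q ∃q : Quant

Prefix : ℕ → Set
Prefix m = Fin m → Quant

record Lit (m : ℕ) : Set where
  constructor lit
  field
    var : Fin m
    pos : Bool
open Lit public

neg : ∀ {m} → Lit m → Lit m
neg (lit v b) = lit v (not b)

-- clauses are viewed as SETS of literals: a clause is a list, and all
-- rules/conditions only ever refer to membership (_∈_).
Clause : ℕ → Set
Clause m = List (Lit m)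

CNF : ℕ → Set
CNF m = List (Clause m)

_≋_ : ∀ {m} → Clause m → Clause m → Set
C ≋ D = ∀ l → (l ∈ C) ⇔ (l ∈ D)

Tautology : ∀ {m} → Clause m → Set
Tautology C = ∃ λ l → l ∈ C × neg l ∈ C

_<P_ : ∀ {m} → Fin m → Fin m → Set
i <P j = toℕ i < toℕ j

Resolvent : ∀ {m} → Prefix m → Clause m → Clause m → Clause m → Set
Resolvent Q D₁ D₂ E =
  Σ _ λ x → Q x ≡ ∃q × lit x true ∈ D₁ × lit x false ∈ D₂ ×
    (∀ l → (l ∈ E) ⇔ ((l ∈ D₁ × l ≢ lit x true) ⊎ (l ∈ D₂ × l ≢ lit x false))) ×
    ¬ Tautology E

Reduct : ∀ {m} → Prefix m → Clause m → Clause m → Set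
Reduct Q D E =
  Σ (Lit _) λ l → Q (var l) ≡ ∀q × l ∈ D ×
    (∀ k → (k ∈ E) ⇔ (k ∈ D × k ≢ l)) ×
    neg l ∉ E ×
    (∀ k → k ∈ E → Q (var k) ≡ ∃q → var k <P var l)

SameBlock : ∀ {m} → Prefix m → Fin m → Fin m → Set
SameBlock Q i j = ∀ k → ((toℕ i Data.Nat.≤ toℕ k × toℕ k Data.Nat.≤ toℕ j) ⊎
                         (toℕ j Data.Nat.≤ toℕ k × toℕ k Data.Nat.≤ toℕ i)) → Q k ≡ Q i

Admissible : ∀ {m} → Prefix m → (Lit m → Lit m) → Set
Admissible Q σ =
  Bijective _≡_ _≡_ σ ×
  (∀ l → σ (neg l) ≡ neg (σ l)) ×
  (∀ x b → SameBlock Q x (var (σ (lit x b))))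

-- σ maps φ to itself up to reordering of clauses and of literals
-- (clauses compared as literal sets, the CNF compared as a set of clauses)
Symmetry : ∀ {m} → Prefix m → CNF m → (Lit m → Lit m) → Set
Symmetry Q φ σ =
  Admissible Q σ ×
  (∀ C → C ∈ φ → ∃ λ D → D ∈ φ × map σ C ≋ D) ×
  (∀ D → D ∈ φ → ∃ λ C → C ∈ φ × map σ C ≋ D)

-- Derivations as sequences (DAG-like proofs).  Deriv Q φ Γ k : the list
-- Γ (most recent first) of derived clauses is a valid derivation whose
-- number of applications of the rules R, U, S is k (axioms A not counted).

data Deriv {m} (Q : Prefix m) (φ : CNF m) : List (Clause m) → ℕ → Set where
  start : Deriv Q φ [] 0
  axiom : ∀ {Γ k C} → Deriv Q φ Γ k → C ∈ φ → Deriv Q φ (C ∷ Γ) k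
  res   : ∀ {Γ k D₁ D₂ E} → Deriv Q φ Γ k → D₁ ∈ Γ → D₂ ∈ Γ →
          Resolvent Q D₁ D₂ E → Deriv Q φ (E ∷ Γ) (suc k)
  red   : ∀ {Γ k D E} → Deriv Q φ Γ k → D ∈ Γ →
          Reduct Q D E → Deriv Q φ (E ∷ Γ) (suc k)
  sym   : ∀ {Γ k D E} (σ : Lit m → Lit m) → Deriv Q φ Γ k → D ∈ Γ →
          Symmetry Q φ σ → E ≋ map σ D → Deriv Q φ (E ∷ Γ) (suc k)

RefutableIn : ∀ {m} → Prefix m → CNF m → ℕ → Set
RefutableIn Q φ s =
  ∃ λ Γ → ∃ λ k → Deriv Q φ Γ k × [] ∈ Γ × k Data.Nat.≤ s

-- KBKF_n for n = suc k ≥ 1.  Variables (4n of them), in prefix order: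
--   x_1 y_1 a_1 x_2 y_2 a_2 ... x_n y_n a_n z_1 ... z_n
-- Index j : Fin n stands for the paper's j+1.

module KBKF (k : ℕ) where
  n : ℕ
  n = suc k

  M : ℕ
  M = n * 3 + n

  xv yv av zv : Fin n → Fin M
  xv j = combine j (fzero {2}) ↑ˡ n
  yv j = combine j (fsuc {2} fzero) ↑ˡ n
  av j = combine j (fsuc {2} (fsuc {1} fzero)) ↑ˡ n
  zv j = (n * 3) ↑ʳ j

  -- ∀ exactly on the a_j (positions 3j+2 below 3n), ∃ elsewhere
  prefix : Prefix M
  prefix i = if (toℕ i <ᵇ n * 3) then (if (toℕ i % 3 Data.Nat.≡ᵇ 2) then ∀q else ∃q) else ∃q

  + - : Fin M → Lit M
  + v = lit v true
  - v = lit v false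

  j₀ : Fin n
  j₀ = fzero

  jₙ : Fin n
  jₙ = Data.Fin.fromℕ k

  zbar : Clause M
  zbar = map (λ j → - (zv j)) (allFin n)

  C₁ : Clause M
  C₁ = - (xv j₀) ∷ - (yv j₀) ∷ []

  -- C_{2j}, C_{2j+1} for j = 1..n-1 (j : Fin k, paper index toℕ j + 1)
  Cmid : Fin k → List (Clause M)
  Cmid j = (+ (xv (inject₁ j)) ∷ - (av (inject₁ j)) ∷ - (xv (fsuc j)) ∷ - (yv (fsuc j)) ∷ [])
         ∷ (+ (yv (inject₁ j)) ∷ + (av (inject₁ j)) ∷ - (xv (fsuc j)) ∷ - (yv (fsuc j)) ∷ [])
         ∷ []

  C₂ₙ C₂ₙ₊₁ : Clause M
  C₂ₙ = + (xv jₙ) ∷ - (av jₙ) ∷ zbar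
  C₂ₙ₊₁ = + (yv jₙ) ∷ + (av jₙ) ∷ zbar

  Bs : Fin n → List (Clause M)
  Bs j = (+ (av j) ∷ + (zv j) ∷ []) ∷ (- (av j) ∷ + (zv j) ∷ []) ∷ []

  matrix : CNF M
  matrix = C₁ ∷ concat (map Cmid (allFin k)) ++ (C₂ₙ ∷ C₂ₙ₊₁ ∷ concat (map Bs (allFin n)))

-- Resolving C_{2n} = x_n ∨ ā_n ∨ z̄_1 ∨ … ∨ z̄_n with B_{2j} = ā_j ∨ z_j for j = 1, …, n
-- and reducing ā_n yields x_n ∨ ā_1 ∨ … ∨ ā_{n-1}; the symmetry σ_n exchanging x_n ↔ y_n
-- and a_n ↔ ā_n turns it into y_n ∨ ā_1 ∨ … ∨ ā_{n-1} in one more step.  Given the pair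
-- x_{j+1} ∨ ā_1 ∨ … ∨ ā_j and y_{j+1} ∨ ā_1 ∨ … ∨ ā_j, resolving with C_{2j} on x_{j+1},
-- then on y_{j+1}, and reducing ā_j gives x_j ∨ ā_1 ∨ … ∨ ā_{j-1}, whose σ_j-image is its
-- y-twin: four steps per level.  Finally x_1 and y_1 refute C_1 = x̄_1 ∨ ȳ_1 in two
-- resolutions, for n + 2 + 4(n - 1) + 2 = 5n steps in all.
--
-- Each clause is handled through its indicator: a Boolean function of a literal's kind
-- (x, y, a, z), index and sign.  Every rule application then reduces to a pointwise
-- identity between Booleans, checked by case analysis.

module Submission where

open import Defs
open import Data.Bool using (Bool; true; false; not; _∧_; _∨_; T; T?; if_then_else_)
open import Data.Bool.Properties
  using (T-∧; T-∨; T-≡; not-involutive; ∨-identityʳ; ∨-zeroʳ; ∧-identityʳ) renaming (_≟_ to _≟ᴮ_)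
open import Data.Empty using (⊥; ⊥-elim)
open import Data.Fin using (Fin; toℕ; inject₁; combine; _↑ˡ_; splitAt; remQuot; fromℕ<)
  renaming (zero to fzero; suc to fsuc)
open import Data.Fin.Properties
  using (toℕ-injective; splitAt-↑ˡ; splitAt-↑ʳ; splitAt⁻¹-↑ˡ; splitAt⁻¹-↑ʳ; remQuot-combine;
         combine-remQuot; toℕ-combine; toℕ-↑ˡ; toℕ-↑ʳ; toℕ<n; toℕ-fromℕ; toℕ-fromℕ<; toℕ-inject₁)
open import Data.List using (List; []; _∷_; map; concat; allFin; filterᵇ; cartesianProductWith)
open import Data.List.Properties using (map-∘; map-cong)
open import Data.List.Membership.Propositional using (_∈_)
open import Data.List.Membership.Propositional.Properties
  using (∈-map⁺; ∈-map⁻; ∈-++⁺ˡ; ∈-++⁺ʳ; ∈-++⁻; ∈-allFin; ∈-concat⁺′; ∈-concat⁻′;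
         ∈-filter⁺; ∈-filter⁻; ∈-cartesianProductWith⁺)
open import Data.List.Relation.Unary.Any using (here; there)
open import Data.Nat using (ℕ; zero; suc; _+_; _*_; _<_; _≤_; _<ᵇ_; _≡ᵇ_; _%_; s≤s⁻¹; z<s; s<s)
open import Data.Nat.DivMod using ([m+kn]%n≡m%n; m<n⇒m%n≡m)
open import Data.Nat.Properties
  using (≤-refl; ≤-trans; ≤-antisym; ≤-total; ≤-reflexive; <⇒≤; n≮n; n<1+n; m<m+n; m+n≮m; 1+n≢n;
         m≤n⇒m<n∨m≡n; <⇒<ᵇ; <ᵇ⇒<; ≡ᵇ⇒≡; ≡⇒≡ᵇ; +-comm; +-suc; +-identityʳ; *-comm; *-suc;
         +-monoʳ-<; *-monoʳ-≤; module ≤-Reasoning)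
open import Data.Nat.Tactic.RingSolver using (solve-∀)
open import Data.Product using (∃; ∃₂; _×_; _,_; proj₁; proj₂; uncurry)
open import Data.Sum using (_⊎_; inj₁; inj₂; swap)
open import Data.Sum.Function.Propositional using (_⊎-⇔_)
open import Data.Product.Function.NonDependent.Propositional using (_×-⇔_)
open import Function using (_∘_)
open import Function.Bundles using (_⇔_; mk⇔; Equivalence; Bijection; mk↔ₛ′)
open import Function.Properties.Equivalence using () renaming (refl to ⇔-refl; sym to ⇔-sym; trans to ⇔-trans)
open import Function.Definitions using (Bijective)
open import Function.Properties.Inverse using (↔⇒⤖)
open import Relation.Binary.PropositionalEquality
  using (_≡_; _≢_; refl; cong; cong₂; trans; subst; subst₂; module ≡-Reasoning)
  renaming (sym to ≡-sym)
open import Relation.Nullary using (¬_)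
open import Relation.Nullary.Decidable using (⌊_⌋; toWitness; fromWitness)

open Equivalence using (to; from)

T-not : ∀ {b} → T (not b) ⇔ (¬ T b)
T-not {true}  = mk⇔ (λ ()) (λ ¬t → ¬t _)
T-not {false} = mk⇔ (λ _ ()) (λ _ → _)

¬-⇔ : ∀ {P Q : Set} → P ⇔ Q → (¬ P) ⇔ (¬ Q)
¬-⇔ P⇔Q = mk⇔ (λ ¬p q → ¬p (from P⇔Q q)) (λ ¬q p → ¬q (to P⇔Q p))

T-cong : ∀ {a b} → a ≡ b → T a ⇔ T b
T-cong refl = ⇔-refl

<ᵇ-true : ∀ {m n} → m < n → (m <ᵇ n) ≡ true
<ᵇ-true m<n = to T-≡ (<⇒<ᵇ m<n)

<ᵇ-false : ∀ {m n} → ¬ m < n → (m <ᵇ n) ≡ false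
<ᵇ-false {m} {n} m≮n with m <ᵇ n in eq
... | true  = ⊥-elim (m≮n (<ᵇ⇒< m n (from T-≡ eq)))
... | false = refl

≡ᵇ-refl : ∀ r → T (r ≡ᵇ r)
≡ᵇ-refl r = ≡⇒≡ᵇ r r refl

<ᵇ-irrefl : ∀ r → (r <ᵇ r) ≡ false
<ᵇ-irrefl r = <ᵇ-false (n≮n r)

≡ᵇ⇒<ᵇ-false : ∀ j r → T (j ≡ᵇ r) → (j <ᵇ r) ≡ false
≡ᵇ⇒<ᵇ-false j r j≡r = trans (cong (_<ᵇ r) (≡ᵇ⇒≡ j r j≡r)) (<ᵇ-irrefl r)

<ᵇ-suc : ∀ j r → (j <ᵇ suc r) ≡ ((j ≡ᵇ r) ∨ (j <ᵇ r))
<ᵇ-suc zero    zero    = refl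
<ᵇ-suc zero    (suc r) = refl
<ᵇ-suc (suc j) zero    = refl
<ᵇ-suc (suc j) (suc r) = <ᵇ-suc j r

3*j+c<3*n : ∀ {j c n} → c < 3 → j < n → 3 * j + c < n * 3
3*j+c<3*n {j} {c} {n} c<3 j<n = begin-strict
  3 * j + c  <⟨ +-monoʳ-< (3 * j) c<3 ⟩
  3 * j + 3  ≡⟨ +-comm (3 * j) 3 ⟩
  3 + 3 * j  ≡⟨ *-suc 3 j ⟨
  3 * suc j  ≤⟨ *-monoʳ-≤ 3 j<n ⟩
  3 * n      ≡⟨ *-comm 3 n ⟩
  n * 3      ∎
  where open ≤-Reasoning

3*j+c%3≡c : ∀ j {c} → c < 3 → (3 * j + c) % 3 ≡ c
3*j+c%3≡c j {c} c<3 = begin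
  (3 * j + c) % 3  ≡⟨ cong (_% 3) (trans (+-comm (3 * j) c) (cong (c +_) (*-comm 3 j))) ⟩
  (c + j * 3) % 3  ≡⟨ [m+kn]%n≡m%n c j 3 ⟩
  c % 3            ≡⟨ m<n⇒m%n≡m c<3 ⟩
  c                ∎
  where open ≡-Reasoning

≤-≤suc⇒≡⊎≡suc : ∀ {p q} → p ≤ q → q ≤ suc p → q ≡ p ⊎ q ≡ suc p
≤-≤suc⇒≡⊎≡suc p≤q q≤1+p with m≤n⇒m<n∨m≡n q≤1+p
... | inj₁ q<1+p = inj₁ (≤-antisym (s≤s⁻¹ q<1+p) p≤q)
... | inj₂ q≡1+p = inj₂ q≡1+p

step-count : ∀ k → 2 + (k * 4 + (2 + suc k)) ≡ 5 * suc k
step-count = solve-∀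

module _ {m : ℕ} where

  ≋-refl : {C : Clause m} → C ≋ C
  ≋-refl l = mk⇔ (λ p → p) (λ p → p)

  ≋-swap : (a b : Lit m) (C : Clause m) → (a ∷ b ∷ C) ≋ (b ∷ a ∷ C)
  ≋-swap a b C l = mk⇔ exchange exchange
    where
      exchange : ∀ {a b} → l ∈ a ∷ b ∷ C → l ∈ b ∷ a ∷ C
      exchange (here p)          = there (here p)
      exchange (there (here p))  = here p
      exchange (there (there p)) = there (there p)

  ≋-cons : (a : Lit m) {C D : Clause m} → C ≋ D → (a ∷ C) ≋ (a ∷ D)
  ≋-cons a C≋D l = mk⇔ (step (to (C≋D l))) (step (from (C≋D l)))
    where
      step : ∀ {C D} → (l ∈ C → l ∈ D) → l ∈ a ∷ C → l ∈ a ∷ D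
      step f (here p)  = here p
      step f (there p) = there (f p)

  module _ {σ : Lit m → Lit m} (σ-involutive : ∀ l → σ (σ l) ≡ l) where

    involution-bijective : Bijective _≡_ _≡_ σ
    involution-bijective = Bijection.bijective (↔⇒⤖ (mk↔ₛ′ σ σ σ-involutive σ-involutive))

    ∈-map-involution : ∀ C l → (l ∈ map σ C) ⇔ (σ l ∈ C)
    ∈-map-involution C l = mk⇔ forth back
      where
        forth : l ∈ map σ C → σ l ∈ C
        forth p with ∈-map⁻ σ p
        ... | l' , l'∈C , refl = subst (_∈ C) (≡-sym (σ-involutive l')) l'∈C
        back : σ l ∈ C → l ∈ map σ C
        back p = subst (_∈ map σ C) (σ-involutive l) (∈-map⁺ σ p)

    image-≋ : ∀ {C D} → map σ C ≋ D → map σ D ≋ C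
    image-≋ {C} {D} σC≋D l = mk⇔
      (λ p → subst (_∈ C) (σ-involutive l)
               (to (∈-map-involution C (σ l)) (from (σC≋D (σ l)) (to (∈-map-involution D l) p))))
      (λ p → from (∈-map-involution D l)
               (to (σC≋D (σ l)) (from (∈-map-involution C (σ l)) (subst (_∈ C) (≡-sym (σ-involutive l)) p))))

    -- An involution that maps every clause of φ into φ is onto φ as well.
    involution-symmetry : ∀ {Q φ} → (∀ l → σ (neg l) ≡ neg (σ l)) →
      (∀ x b → SameBlock Q x (var (σ (lit x b)))) →
      (∀ C → C ∈ φ → ∃ λ D → D ∈ φ × map σ C ≋ D) → Symmetry Q φ σ
    involution-symmetry σ-neg σ-block σφ⊆φ =
      (involution-bijective , σ-neg , σ-block) , σφ⊆φ ,
      λ D D∈φ → let (C , C∈φ , σD≋C) = σφ⊆φ D D∈φ in C , C∈φ , image-≋ σD≋C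

  SameBlock-refl : ∀ {Q : Prefix m} i → SameBlock Q i i
  SameBlock-refl {Q} i v (inj₁ (i≤v , v≤i)) = cong Q (toℕ-injective (≤-antisym v≤i i≤v))
  SameBlock-refl {Q} i v (inj₂ (i≤v , v≤i)) = cong Q (toℕ-injective (≤-antisym v≤i i≤v))

  SameBlock-sym : ∀ {Q : Prefix m} {i j} → SameBlock Q i j → SameBlock Q j i
  SameBlock-sym {Q} {i} {j} block v between = trans (block v (swap between)) (≡-sym (block j j-between))
    where
      j-between : (toℕ i ≤ toℕ j × toℕ j ≤ toℕ j) ⊎ (toℕ j ≤ toℕ j × toℕ j ≤ toℕ i)
      j-between with ≤-total (toℕ i) (toℕ j)
      ... | inj₁ i≤j = inj₁ (i≤j , ≤-refl)
      ... | inj₂ j≤i = inj₂ (≤-refl , j≤i)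

data Kind : Set where
  X Y A Z : Kind

_==ᴷ_ : Kind → Kind → Bool
X ==ᴷ X = true
Y ==ᴷ Y = true
A ==ᴷ A = true
Z ==ᴷ Z = true
_ ==ᴷ _ = false

==ᴷ⇒≡ : ∀ κ κ' → T (κ ==ᴷ κ') → κ ≡ κ'
==ᴷ⇒≡ X X _ = refl
==ᴷ⇒≡ Y Y _ = refl
==ᴷ⇒≡ A A _ = refl
==ᴷ⇒≡ Z Z _ = refl

==ᴷ-refl : ∀ κ → T (κ ==ᴷ κ)
==ᴷ-refl X = _
==ᴷ-refl Y = _
==ᴷ-refl A = _
==ᴷ-refl Z = _

module Refutation (k : ℕ) where
  open KBKF k hiding (+ ; -)

  encode : Kind → Fin n → Fin M
  encode X = xv
  encode Y = yv
  encode A = av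
  encode Z = zv

  kindOf : Fin 3 → Kind
  kindOf fzero               = X
  kindOf (fsuc fzero)        = Y
  kindOf (fsuc (fsuc fzero)) = A

  decodeBlock : Fin n × Fin 3 → Kind × Fin n
  decodeBlock (j , r) = kindOf r , j

  decodeSplit : Fin (n * 3) ⊎ Fin n → Kind × Fin n
  decodeSplit (inj₁ u) = decodeBlock (remQuot 3 u)
  decodeSplit (inj₂ j) = Z , j

  encode-decodeBlock : ∀ p → uncurry encode (decodeBlock p) ≡ uncurry combine p ↑ˡ n
  encode-decodeBlock (j , fzero)             = refl
  encode-decodeBlock (j , fsuc fzero)        = refl
  encode-decodeBlock (j , fsuc (fsuc fzero)) = refl

  decode : Fin M → Kind × Fin n
  decode v = decodeSplit (splitAt (n * 3) v)

  decode-combine : ∀ j r → decode (combine j r ↑ˡ n) ≡ (kindOf r , j)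
  decode-combine j r = trans (cong decodeSplit (splitAt-↑ˡ (n * 3) (combine j r) n))
                             (cong decodeBlock (remQuot-combine j r))

  decode-encode : ∀ κ j → decode (encode κ j) ≡ (κ , j)
  decode-encode X j = decode-combine j fzero
  decode-encode Y j = decode-combine j (fsuc fzero)
  decode-encode A j = decode-combine j (fsuc (fsuc fzero))
  decode-encode Z j = cong decodeSplit (splitAt-↑ʳ (n * 3) n j)

  encode-decode : ∀ v → uncurry encode (decode v) ≡ v
  encode-decode v with splitAt (n * 3) v in eq
  ... | inj₁ u =
    trans (encode-decodeBlock (remQuot 3 u)) (trans (cong (_↑ˡ n) (combine-remQuot {n} 3 u)) (splitAt⁻¹-↑ˡ eq))
  ... | inj₂ j = splitAt⁻¹-↑ʳ eq

  encode-surjective : ∀ v → ∃₂ λ κ j → encode κ j ≡ v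
  encode-surjective v = proj₁ (decode v) , proj₂ (decode v) , encode-decode v

  encode-injective : ∀ {κ j κ' j'} → encode κ j ≡ encode κ' j' → (κ , j) ≡ (κ' , j')
  encode-injective {κ} {j} {κ'} {j'} eq =
    trans (≡-sym (decode-encode κ j)) (trans (cong decode eq) (decode-encode κ' j'))

  position : Kind → ℕ → ℕ
  position X j = 3 * j + 0
  position Y j = 3 * j + 1
  position A j = 3 * j + 2
  position Z j = n * 3 + j

  toℕ-encode : ∀ κ j → toℕ (encode κ j) ≡ position κ (toℕ j)
  toℕ-encode X j = trans (toℕ-↑ˡ (combine j fzero) n) (toℕ-combine j fzero)
  toℕ-encode Y j = trans (toℕ-↑ˡ (combine j (fsuc fzero)) n) (toℕ-combine j (fsuc fzero))
  toℕ-encode A j = trans (toℕ-↑ˡ (combine j (fsuc (fsuc fzero))) n) (toℕ-combine j (fsuc (fsuc fzero)))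
  toℕ-encode Z j = toℕ-↑ʳ (n * 3) j

  quantifier : Kind → Quant
  quantifier A = ∀q
  quantifier _ = ∃q

  prefixAt : ℕ → Quant
  prefixAt p = if p <ᵇ n * 3 then (if p % 3 ≡ᵇ 2 then ∀q else ∃q) else ∃q

  prefixAt-block : ∀ j c → c < 3 → j < n → prefixAt (3 * j + c) ≡ (if c ≡ᵇ 2 then ∀q else ∃q)
  prefixAt-block j c c<3 j<n rewrite <ᵇ-true (3*j+c<3*n c<3 j<n) | 3*j+c%3≡c j c<3 = refl

  prefixAt-tail : ∀ j → prefixAt (n * 3 + j) ≡ ∃q
  prefixAt-tail j rewrite <ᵇ-false (m+n≮m (n * 3) j) = refl

  prefix-encode : ∀ κ j → prefix (encode κ j) ≡ quantifier κ
  prefix-encode X j = trans (cong prefixAt (toℕ-encode X j)) (prefixAt-block (toℕ j) 0 z<s (toℕ<n j))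
  prefix-encode Y j = trans (cong prefixAt (toℕ-encode Y j)) (prefixAt-block (toℕ j) 1 (s<s z<s) (toℕ<n j))
  prefix-encode A j = trans (cong prefixAt (toℕ-encode A j)) (prefixAt-block (toℕ j) 2 (s<s (s<s z<s)) (toℕ<n j))
  prefix-encode Z j = trans (cong prefixAt (toℕ-encode Z j)) (prefixAt-tail (toℕ j))

  prefixAt-x-y : ∀ j p → 3 * toℕ j + 0 ≤ p → p ≤ 3 * toℕ j + 1 → prefixAt p ≡ ∃q
  prefixAt-x-y j p lo hi with ≤-≤suc⇒≡⊎≡suc lo (subst (p ≤_) (+-suc (3 * toℕ j) 0) hi)
  ... | inj₁ refl = prefixAt-block (toℕ j) 0 z<s (toℕ<n j)
  ... | inj₂ refl =
    trans (cong prefixAt (≡-sym (+-suc (3 * toℕ j) 0))) (prefixAt-block (toℕ j) 1 (s<s z<s) (toℕ<n j))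

  x-y-sameBlock : ∀ j → SameBlock prefix (xv j) (yv j)
  x-y-sameBlock j v (inj₁ (x≤v , v≤y)) =
    trans (prefixAt-x-y j (toℕ v) (subst (_≤ toℕ v) (toℕ-encode X j) x≤v)
                                  (subst (toℕ v ≤_) (toℕ-encode Y j) v≤y))
          (≡-sym (prefix-encode X j))
  x-y-sameBlock j v (inj₂ (y≤v , v≤x)) = ⊥-elim (n≮n (3 * toℕ j + 0)
    (subst (_≤ 3 * toℕ j + 0) (+-suc (3 * toℕ j) 0)
      (≤-trans (subst (_≤ toℕ v) (toℕ-encode Y j) y≤v) (subst (toℕ v ≤_) (toℕ-encode X j) v≤x))))

  -- Clauses as indicator functions

  Indicator : Set
  Indicator = Kind → ℕ → Bool → Bool

  -- As encode is onto, an indicator determines a clause as a set of literals.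
  record IsIndicator (χ : Indicator) (C : Clause M) : Set where
    field
      ∈⇔T : ∀ κ j b → (lit (encode κ j) b ∈ C) ⇔ T (χ κ (toℕ j) b)
  open IsIndicator

  _≐_ : Indicator → Indicator → Set
  χ ≐ ψ = ∀ κ j b → χ κ j b ≡ ψ κ j b

  none : Indicator
  none _ _ _ = false

  single : Kind → ℕ → Bool → Indicator
  single κ' r b' κ j b = (κ ==ᴷ κ') ∧ ⌊ b ≟ᴮ b' ⌋ ∧ (j ≡ᵇ r)

  _∪_ _∖_ : Indicator → Indicator → Indicator
  (χ ∪ ψ) κ j b = χ κ j b ∨ ψ κ j b
  (χ ∖ ψ) κ j b = χ κ j b ∧ not (ψ κ j b)

  single-correct : ∀ κ' j' b' κ j b →
    T (single κ' (toℕ j') b' κ (toℕ j) b) ⇔ (lit (encode κ j) b ≡ lit (encode κ' j') b')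
  single-correct κ' j' b' κ j b = mk⇔ forth back
    where
      forth : T (single κ' (toℕ j') b' κ (toℕ j) b) → lit (encode κ j) b ≡ lit (encode κ' j') b'
      forth t with to T-∧ t
      ... | κ≡κ' , t' with to T-∧ t'
      ... | b≡b' , j≡j' =
        cong₂ lit (cong₂ encode (==ᴷ⇒≡ κ κ' κ≡κ') (toℕ-injective (≡ᵇ⇒≡ _ _ j≡j'))) (toWitness b≡b')
      back : lit (encode κ j) b ≡ lit (encode κ' j') b' → T (single κ' (toℕ j') b' κ (toℕ j) b)
      back eq with encode-injective {κ} {j} {κ'} {j'} (cong var eq) | cong pos eq
      ... | refl | refl = from T-∧ (==ᴷ-refl κ , from T-∧ (fromWitness refl , ≡⇒≡ᵇ (toℕ j) (toℕ j) refl))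

  T-∖ : ∀ χ ψ κ j b → T ((χ ∖ ψ) κ j b) ⇔ (T (χ κ j b) × ¬ T (ψ κ j b))
  T-∖ χ ψ κ j b = ⇔-trans T-∧ (mk⇔ (λ (p , q) → p , to T-not q) (λ (p , q) → p , from T-not q))

  []-isIndicator : IsIndicator none []
  ∈⇔T []-isIndicator κ j b = mk⇔ (λ ()) (λ ())

  ∷-isIndicator : ∀ {χ C} κ' j' b' → IsIndicator χ C →
    IsIndicator (single κ' (toℕ j') b' ∪ χ) (lit (encode κ' j') b' ∷ C)
  ∈⇔T (∷-isIndicator {χ} {C} κ' j' b' isC) κ j b = mk⇔ forth back
    where
      forth : lit (encode κ j) b ∈ lit (encode κ' j') b' ∷ C → T ((single κ' (toℕ j') b' ∪ χ) κ (toℕ j) b)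
      forth (here eq) = from T-∨ (inj₁ (from (single-correct κ' j' b' κ j b) eq))
      forth (there p) = from (T-∨ {single κ' (toℕ j') b' κ (toℕ j) b}) (inj₂ (to (∈⇔T isC κ j b) p))
      back : T ((single κ' (toℕ j') b' ∪ χ) κ (toℕ j) b) → lit (encode κ j) b ∈ lit (encode κ' j') b' ∷ C
      back t with to T-∨ t
      ... | inj₁ t₁ = here (to (single-correct κ' j' b' κ j b) t₁)
      ... | inj₂ t₂ = there (from (∈⇔T isC κ j b) t₂)

  isIndicator-cong : ∀ {χ ψ C} → (∀ κ j b → j < n → χ κ j b ≡ ψ κ j b) →
    IsIndicator χ C → IsIndicator ψ C
  ∈⇔T (isIndicator-cong χ≡ψ isC) κ j b =
    ⇔-trans (∈⇔T isC κ j b) (T-cong (χ≡ψ κ (toℕ j) b (toℕ<n j)))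

  isIndicator-≋ : ∀ {χ C D} → IsIndicator χ C → IsIndicator χ D → C ≋ D
  isIndicator-≋ isC isD (lit v b) with encode-surjective v
  ... | κ , j , refl = ⇔-trans (∈⇔T isC κ j b) (⇔-sym (∈⇔T isD κ j b))

  ⟦_⟧ : Indicator → Lit M → Bool
  ⟦ χ ⟧ (lit v b) = χ (proj₁ (decode v)) (toℕ (proj₂ (decode v))) b

  allLiterals : List (Lit M)
  allLiterals = cartesianProductWith lit (allFin M) (true ∷ false ∷ [])

  ∈-allLiterals : ∀ l → l ∈ allLiterals
  ∈-allLiterals (lit v b) = ∈-cartesianProductWith⁺ lit {allFin M} {true ∷ false ∷ []} (∈-allFin v) (b∈ b)
    where
      b∈ : ∀ b → b ∈ true ∷ false ∷ []
      b∈ true  = here refl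
      b∈ false = there (here refl)

  clause : Indicator → Clause M
  clause χ = filterᵇ ⟦ χ ⟧ allLiterals

  clause-isIndicator : ∀ χ → IsIndicator χ (clause χ)
  ∈⇔T (clause-isIndicator χ) κ j b = mk⇔
    (λ p → subst T (⟦⟧-encode) (proj₂ (∈-filter⁻ (T? ∘ ⟦ χ ⟧) p)))
    (λ t → ∈-filter⁺ (T? ∘ ⟦ χ ⟧) (∈-allLiterals _) (subst T (≡-sym ⟦⟧-encode) t))
    where
      ⟦⟧-encode : ⟦ χ ⟧ (lit (encode κ j) b) ≡ χ κ (toℕ j) b
      ⟦⟧-encode = cong (λ d → χ (proj₁ d) (toℕ (proj₂ d)) b) (decode-encode κ j)

  NonTautological : Indicator → Set
  NonTautological χ = ∀ κ j → T (χ κ j true) → T (χ κ j false) → ⊥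

  ∖-single-correct : ∀ {χ D} κ j b → IsIndicator χ D → ∀ κ' j' b' →
    T ((χ ∖ single κ (toℕ j) b) κ' (toℕ j') b') ⇔
      (lit (encode κ' j') b' ∈ D × lit (encode κ' j') b' ≢ lit (encode κ j) b)
  ∖-single-correct {χ} κ j b isD κ' j' b' =
    ⇔-trans (T-∖ χ (single κ (toℕ j) b) κ' (toℕ j') b')
      (⇔-sym (∈⇔T isD κ' j' b') ×-⇔ ¬-⇔ (single-correct κ j b κ' j' b'))

  -- The pivot is given both as j : Fin n and as its index r, so that the conditions
  -- on the indicators can be checked by computation on r.
  resolvent : ∀ {C₁ C₂ C χ₁ χ₂ χ} κ (j : Fin n) {r} → toℕ j ≡ r → quantifier κ ≡ ∃q →
    IsIndicator χ₁ C₁ → IsIndicator χ₂ C₂ → IsIndicator χ C →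
    T (χ₁ κ r true) → T (χ₂ κ r false) →
    χ ≐ ((χ₁ ∖ single κ r true) ∪ (χ₂ ∖ single κ r false)) → NonTautological χ →
    Resolvent prefix C₁ C₂ C
  resolvent {C₁} {C₂} {C} {χ₁} {χ₂} {χ} κ j refl ∃κ isC₁ isC₂ isC x∈C₁ x̄∈C₂ χ≐ nonTautological =
    encode κ j , trans (prefix-encode κ j) ∃κ ,
    from (∈⇔T isC₁ κ j true) x∈C₁ , from (∈⇔T isC₂ κ j false) x̄∈C₂ , members , tautology-free
    where
      members : ∀ l →
        (l ∈ C) ⇔ ((l ∈ C₁ × l ≢ lit (encode κ j) true) ⊎ (l ∈ C₂ × l ≢ lit (encode κ j) false))
      members (lit v b) with encode-surjective v
      ... | κ' , j' , refl =
        ⇔-trans (∈⇔T isC κ' j' b) (⇔-trans (T-cong (χ≐ κ' (toℕ j') b))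
          (⇔-trans (T-∨ {(χ₁ ∖ single κ (toℕ j) true) κ' (toℕ j') b})
            (∖-single-correct {χ₁} κ j true isC₁ κ' j' b ⊎-⇔
             ∖-single-correct {χ₂} κ j false isC₂ κ' j' b)))
      tautology-free : ¬ Tautology C
      tautology-free (lit v b , p , q) with encode-surjective v
      ... | κ' , j' , refl = both-signs b p q
        where
          both-signs : ∀ b → lit (encode κ' j') b ∈ C → lit (encode κ' j') (not b) ∈ C → ⊥
          both-signs true  p q = nonTautological κ' (toℕ j') (to (∈⇔T isC κ' j' true) p) (to (∈⇔T isC κ' j' false) q)
          both-signs false p q = nonTautological κ' (toℕ j') (to (∈⇔T isC κ' j' true) q) (to (∈⇔T isC κ' j' false) p)

  reduct : ∀ {C C' χ χ'} (j : Fin n) {r} → toℕ j ≡ r → ∀ b → IsIndicator χ C → IsIndicator χ' C' →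
    T (χ A r b) → χ' ≐ (χ ∖ single A r b) → ¬ T (χ' A r (not b)) →
    (∀ κ i b' → T (χ' κ i b') → quantifier κ ≡ ∃q → position κ i < position A r) →
    Reduct prefix C C'
  reduct {C} {C'} {χ} {χ'} j refl b isC isC' a∈C χ'≐ ā∉C' precedes =
    lit (encode A j) b , prefix-encode A j , from (∈⇔T isC A j b) a∈C , members ,
    ā∉C' ∘ to (∈⇔T isC' A j (not b)) , ordered
    where
      members : ∀ l → (l ∈ C') ⇔ (l ∈ C × l ≢ lit (encode A j) b)
      members (lit v b') with encode-surjective v
      ... | κ , i , refl =
        ⇔-trans (∈⇔T isC' κ i b') (⇔-trans (T-cong (χ'≐ κ (toℕ i) b')) (∖-single-correct {χ} A j b isC κ i b'))
      ordered : ∀ l → l ∈ C' → prefix (var l) ≡ ∃q → var l <P encode A j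
      ordered (lit v b') p ∃v with encode-surjective v
      ... | κ , i , refl = subst₂ _<_ (≡-sym (toℕ-encode κ i)) (≡-sym (toℕ-encode A j))
        (precedes κ (toℕ i) b' (to (∈⇔T isC' κ i b') p) (trans (≡-sym (prefix-encode κ i)) ∃v))

  -- The symmetries σ_t

  swapKind : Kind → Kind
  swapKind X = Y
  swapKind Y = X
  swapKind A = A
  swapKind Z = Z

  swapSign : Kind → Bool → Bool
  swapSign A b = not b
  swapSign _ b = b

  swapLiteral : Bool → Kind → Fin n → Bool → Lit M
  swapLiteral true  κ j b = lit (encode (swapKind κ) j) (swapSign κ b)
  swapLiteral false κ j b = lit (encode κ j) b

  σ : ℕ → Lit M → Lit M
  σ t (lit v b) = let (κ , j) = decode v in swapLiteral (toℕ j ≡ᵇ t) κ j b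

  σ-encode : ∀ t κ j b → σ t (lit (encode κ j) b) ≡ swapLiteral (toℕ j ≡ᵇ t) κ j b
  σ-encode t κ j b = cong (λ (κ , j) → swapLiteral (toℕ j ≡ᵇ t) κ j b) (decode-encode κ j)

  swapLiteral-involutive : ∀ t κ j b → σ t (swapLiteral (toℕ j ≡ᵇ t) κ j b) ≡ lit (encode κ j) b
  swapLiteral-involutive t κ j b with toℕ j ≡ᵇ t in eq
  ... | false = trans (σ-encode t κ j b) (cong (λ e → swapLiteral e κ j b) eq)
  ... | true  = begin
    σ t (lit (encode (swapKind κ) j) (swapSign κ b))        ≡⟨ σ-encode t (swapKind κ) j (swapSign κ b) ⟩
    swapLiteral (toℕ j ≡ᵇ t) (swapKind κ) j (swapSign κ b)  ≡⟨ cong (λ e → swapLiteral e (swapKind κ) j (swapSign κ b)) eq ⟩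
    swapLiteral true (swapKind κ) j (swapSign κ b)           ≡⟨ swapped κ b ⟩
    lit (encode κ j) b                                       ∎
    where
      open ≡-Reasoning
      swapped : ∀ κ b → swapLiteral true (swapKind κ) j (swapSign κ b) ≡ lit (encode κ j) b
      swapped X b = refl
      swapped Y b = refl
      swapped A b = cong (lit (encode A j)) (not-involutive b)
      swapped Z b = refl

  σ-involutive : ∀ t l → σ t (σ t l) ≡ l
  σ-involutive t (lit v b) with encode-surjective v
  ... | κ , j , refl = trans (cong (σ t) (σ-encode t κ j b)) (swapLiteral-involutive t κ j b)

  σ-neg : ∀ t l → σ t (neg l) ≡ neg (σ t l)
  σ-neg t (lit v b) with encode-surjective v
  ... | κ , j , refl =
    trans (σ-encode t κ j (not b)) (trans (swapLiteral-neg (toℕ j ≡ᵇ t) κ) (cong neg (≡-sym (σ-encode t κ j b))))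
    where
      swapLiteral-neg : ∀ e κ → swapLiteral e κ j (not b) ≡ neg (swapLiteral e κ j b)
      swapLiteral-neg false κ = refl
      swapLiteral-neg true  X = refl
      swapLiteral-neg true  Y = refl
      swapLiteral-neg true  A = refl
      swapLiteral-neg true  Z = refl

  σ-sameBlock : ∀ t v b → SameBlock prefix v (var (σ t (lit v b)))
  σ-sameBlock t v b with encode-surjective v
  ... | κ , j , refl rewrite σ-encode t κ j b = sameBlock (toℕ j ≡ᵇ t) κ
    where
      sameBlock : ∀ e κ → SameBlock prefix (encode κ j) (var (swapLiteral e κ j b))
      sameBlock false κ = SameBlock-refl (encode κ j)
      sameBlock true  X = x-y-sameBlock j
      sameBlock true  Y = SameBlock-sym (x-y-sameBlock j)
      sameBlock true  A = SameBlock-refl (encode A j)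
      sameBlock true  Z = SameBlock-refl (encode Z j)

  swapAt : ℕ → Indicator → Indicator
  swapAt t χ κ j b = if j ≡ᵇ t then χ (swapKind κ) j (swapSign κ b) else χ κ j b

  map-σ-isIndicator : ∀ {χ C} t → IsIndicator χ C → IsIndicator (swapAt t χ) (map (σ t) C)
  ∈⇔T (map-σ-isIndicator {χ} {C} t isC) κ j b =
    ⇔-trans (∈-map-involution (σ-involutive t) C (lit (encode κ j) b))
      (subst (λ l → (l ∈ C) ⇔ T (swapAt t χ κ (toℕ j) b)) (≡-sym (σ-encode t κ j b)) (swapped (toℕ j ≡ᵇ t)))
    where
      swapped : ∀ e →
        (swapLiteral e κ j b ∈ C) ⇔ T (if e then χ (swapKind κ) (toℕ j) (swapSign κ b) else χ κ (toℕ j) b)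
      swapped true  = ∈⇔T isC (swapKind κ) j (swapSign κ b)
      swapped false = ∈⇔T isC κ j b

  Literals : Set
  Literals = List (Kind × Fin n × Bool)

  literals : Literals → Clause M
  literals = map (λ (κ , j , b) → lit (encode κ j) b)

  map-σ-literals : ∀ t ls →
    map (σ t) (literals ls) ≡ map (λ (κ , j , b) → swapLiteral (toℕ j ≡ᵇ t) κ j b) ls
  map-σ-literals t []                = refl
  map-σ-literals t ((κ , j , b) ∷ ls) = cong₂ _∷_ (σ-encode t κ j b) (map-σ-literals t ls)

  σ-fixes-z : ∀ t j b → σ t (lit (zv j) b) ≡ lit (zv j) b
  σ-fixes-z t j b = trans (σ-encode t Z j b) (fixed (toℕ j ≡ᵇ t))
    where
      fixed : ∀ e → swapLiteral e Z j b ≡ lit (zv j) b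
      fixed true  = refl
      fixed false = refl

  σ-zbar : ∀ t → map (σ t) zbar ≡ zbar
  σ-zbar t = trans (≡-sym (map-∘ (allFin n))) (map-cong (λ j → σ-fixes-z t j false) (allFin n))

  Cx Cy : Fin k → Clause M
  Cx i = literals ((X , inject₁ i , true) ∷ (A , inject₁ i , false) ∷ (X , fsuc i , false) ∷ (Y , fsuc i , false) ∷ [])
  Cy i = literals ((Y , inject₁ i , true) ∷ (A , inject₁ i , true) ∷ (X , fsuc i , false) ∷ (Y , fsuc i , false) ∷ [])

  Ba Bā : Fin n → Clause M
  Ba j = literals ((A , j , true)  ∷ (Z , j , true) ∷ [])
  Bā j = literals ((A , j , false) ∷ (Z , j , true) ∷ [])

  C₁∈ : C₁ ∈ matrix
  C₁∈ = here refl

  Cx∈ : ∀ i → Cx i ∈ matrix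
  Cx∈ i = there (∈-++⁺ˡ (∈-concat⁺′ (here refl) (∈-map⁺ Cmid (∈-allFin i))))

  Cy∈ : ∀ i → Cy i ∈ matrix
  Cy∈ i = there (∈-++⁺ˡ (∈-concat⁺′ (there (here refl)) (∈-map⁺ Cmid (∈-allFin i))))

  C₂ₙ∈ : C₂ₙ ∈ matrix
  C₂ₙ∈ = there (∈-++⁺ʳ _ (here refl))

  C₂ₙ₊₁∈ : C₂ₙ₊₁ ∈ matrix
  C₂ₙ₊₁∈ = there (∈-++⁺ʳ _ (there (here refl)))

  Ba∈ : ∀ j → Ba j ∈ matrix
  Ba∈ j = there (∈-++⁺ʳ _ (there (there (∈-concat⁺′ (here refl) (∈-map⁺ Bs (∈-allFin j))))))

  Bā∈ : ∀ j → Bā j ∈ matrix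
  Bā∈ j = there (∈-++⁺ʳ _ (there (there (∈-concat⁺′ (there (here refl)) (∈-map⁺ Bs (∈-allFin j))))))

  Image : ℕ → Clause M → Set
  Image t C = ∃ λ D → D ∈ matrix × map (σ t) C ≋ D

  image : ∀ t C {L D} → map (σ t) C ≡ L → D ∈ matrix → L ≋ D → Image t C
  image t C refl D∈ L≋D = _ , D∈ , L≋D

  image-C₁ : ∀ t → Image t C₁
  image-C₁ t = by-cases (0 ≡ᵇ t) (map-σ-literals t ((X , j₀ , false) ∷ (Y , j₀ , false) ∷ []))
    where
      by-cases : ∀ e → map (σ t) C₁ ≡ swapLiteral e X j₀ false ∷ swapLiteral e Y j₀ false ∷ [] → Image t C₁
      by-cases true  eq = image t C₁ eq C₁∈ (≋-swap _ _ [])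
      by-cases false eq = image t C₁ eq C₁∈ ≋-refl

  distinct-levels : ∀ t (i : Fin k) → T (toℕ (inject₁ i) ≡ᵇ t) → T (suc (toℕ i) ≡ᵇ t) → ⊥
  distinct-levels t i i≡t 1+i≡t =
    1+n≢n (trans (≡ᵇ⇒≡ _ t 1+i≡t) (trans (≡-sym (≡ᵇ⇒≡ _ t i≡t)) (toℕ-inject₁ i)))

  image-Cx : ∀ t i → Image t (Cx i)
  image-Cx t i = by-cases (toℕ (inject₁ i) ≡ᵇ t) (suc (toℕ i) ≡ᵇ t) (distinct-levels t i) (map-σ-literals t _)
    where
      by-cases : ∀ e e' → (T e → T e' → ⊥) →
        map (σ t) (Cx i) ≡ swapLiteral e X (inject₁ i) true ∷ swapLiteral e A (inject₁ i) false ∷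
                           swapLiteral e' X (fsuc i) false ∷ swapLiteral e' Y (fsuc i) false ∷ [] →
        Image t (Cx i)
      by-cases true  true  both _ = ⊥-elim (both _ _)
      by-cases true  false _ eq = image t (Cx i) eq (Cy∈ i) ≋-refl
      by-cases false true  _ eq = image t (Cx i) eq (Cx∈ i) (≋-cons _ (≋-cons _ (≋-swap _ _ [])))
      by-cases false false _ eq = image t (Cx i) eq (Cx∈ i) ≋-refl

  image-Cy : ∀ t i → Image t (Cy i)
  image-Cy t i = by-cases (toℕ (inject₁ i) ≡ᵇ t) (suc (toℕ i) ≡ᵇ t) (distinct-levels t i) (map-σ-literals t _)
    where
      by-cases : ∀ e e' → (T e → T e' → ⊥) →
        map (σ t) (Cy i) ≡ swapLiteral e Y (inject₁ i) true ∷ swapLiteral e A (inject₁ i) true ∷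
                           swapLiteral e' X (fsuc i) false ∷ swapLiteral e' Y (fsuc i) false ∷ [] →
        Image t (Cy i)
      by-cases true  true  both _ = ⊥-elim (both _ _)
      by-cases true  false _ eq = image t (Cy i) eq (Cx∈ i) ≋-refl
      by-cases false true  _ eq = image t (Cy i) eq (Cy∈ i) (≋-cons _ (≋-cons _ (≋-swap _ _ [])))
      by-cases false false _ eq = image t (Cy i) eq (Cy∈ i) ≋-refl

  image-C₂ₙ : ∀ t → Image t C₂ₙ
  image-C₂ₙ t =
    by-cases (toℕ jₙ ≡ᵇ t) (cong₂ _∷_ (σ-encode t X jₙ true) (cong₂ _∷_ (σ-encode t A jₙ false) (σ-zbar t)))
    where
      by-cases : ∀ e → map (σ t) C₂ₙ ≡ swapLiteral e X jₙ true ∷ swapLiteral e A jₙ false ∷ zbar → Image t C₂ₙ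
      by-cases true  eq = image t C₂ₙ eq C₂ₙ₊₁∈ ≋-refl
      by-cases false eq = image t C₂ₙ eq C₂ₙ∈ ≋-refl

  image-C₂ₙ₊₁ : ∀ t → Image t C₂ₙ₊₁
  image-C₂ₙ₊₁ t =
    by-cases (toℕ jₙ ≡ᵇ t) (cong₂ _∷_ (σ-encode t Y jₙ true) (cong₂ _∷_ (σ-encode t A jₙ true) (σ-zbar t)))
    where
      by-cases : ∀ e → map (σ t) C₂ₙ₊₁ ≡ swapLiteral e Y jₙ true ∷ swapLiteral e A jₙ true ∷ zbar → Image t C₂ₙ₊₁
      by-cases true  eq = image t C₂ₙ₊₁ eq C₂ₙ∈ ≋-refl
      by-cases false eq = image t C₂ₙ₊₁ eq C₂ₙ₊₁∈ ≋-refl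

  image-Ba : ∀ t j → Image t (Ba j)
  image-Ba t j = by-cases (toℕ j ≡ᵇ t) (map-σ-literals t _)
    where
      by-cases : ∀ e → map (σ t) (Ba j) ≡ swapLiteral e A j true ∷ swapLiteral e Z j true ∷ [] → Image t (Ba j)
      by-cases true  eq = image t (Ba j) eq (Bā∈ j) ≋-refl
      by-cases false eq = image t (Ba j) eq (Ba∈ j) ≋-refl

  image-Bā : ∀ t j → Image t (Bā j)
  image-Bā t j = by-cases (toℕ j ≡ᵇ t) (map-σ-literals t _)
    where
      by-cases : ∀ e → map (σ t) (Bā j) ≡ swapLiteral e A j false ∷ swapLiteral e Z j true ∷ [] → Image t (Bā j)
      by-cases true  eq = image t (Bā j) eq (Ba∈ j) ≋-refl
      by-cases false eq = image t (Bā j) eq (Bā∈ j) ≋-refl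

  σ-maps-matrix-into-itself : ∀ t C → C ∈ matrix → Image t C
  σ-maps-matrix-into-itself t C (here refl) = image-C₁ t
  σ-maps-matrix-into-itself t C (there p) with ∈-++⁻ (concat (map Cmid (allFin k))) p
  ... | inj₁ p' with ∈-concat⁻′ (map Cmid (allFin k)) p'
  ... | _ , C∈Cmid , Cmid∈ with ∈-map⁻ Cmid Cmid∈
  ... | i , _ , refl with C∈Cmid
  ... | here refl         = image-Cx t i
  ... | there (here refl) = image-Cy t i
  σ-maps-matrix-into-itself t C (there p) | inj₂ (here refl)         = image-C₂ₙ t
  σ-maps-matrix-into-itself t C (there p) | inj₂ (there (here refl)) = image-C₂ₙ₊₁ t
  σ-maps-matrix-into-itself t C (there p) | inj₂ (there (there p')) with ∈-concat⁻′ (map Bs (allFin n)) p'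
  ... | _ , C∈Bs , Bs∈ with ∈-map⁻ Bs Bs∈
  ... | j , _ , refl with C∈Bs
  ... | here refl         = image-Ba t j
  ... | there (here refl) = image-Bā t j

  σ-symmetry : ∀ t → Symmetry prefix matrix (σ t)
  σ-symmetry t = involution-symmetry (σ-involutive t) (σ-neg t) (σ-sameBlock t) (σ-maps-matrix-into-itself t)

  anyOf : Literals → Indicator
  anyOf []                = none
  anyOf ((κ , j , b) ∷ ls) = single κ (toℕ j) b ∪ anyOf ls

  literals-isIndicator : ∀ ls → IsIndicator (anyOf ls) (literals ls)
  literals-isIndicator []                = []-isIndicator
  literals-isIndicator ((κ , j , b) ∷ ls) = ∷-isIndicator {anyOf ls} κ j b (literals-isIndicator ls)

  z̄ : Indicator
  z̄ Z _ false = true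
  z̄ _ _ _     = false

  zbar-isIndicator : IsIndicator z̄ zbar
  ∈⇔T zbar-isIndicator κ j b = mk⇔ forth (back κ b)
    where
      forth : lit (encode κ j) b ∈ zbar → T (z̄ κ (toℕ j) b)
      forth p with ∈-map⁻ (λ j → lit (zv j) false) p
      ... | j' , _ , eq with encode-injective {κ} {j} {Z} {j'} (cong var eq) | cong pos eq
      ... | refl | refl = _
      back : ∀ κ b → T (z̄ κ (toℕ j) b) → lit (encode κ j) b ∈ zbar
      back Z false _ = ∈-map⁺ (λ j → lit (zv j) false) (∈-allFin j)

  c₁ : Indicator
  c₁ X j false = j ≡ᵇ 0
  c₁ Y j false = j ≡ᵇ 0
  c₁ _ _ _     = false

  C₁-isIndicator : IsIndicator c₁ C₁
  C₁-isIndicator = isIndicator-cong agree (literals-isIndicator ((X , j₀ , false) ∷ (Y , j₀ , false) ∷ []))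
    where
      agree : ∀ κ j b → j < n → anyOf ((X , j₀ , false) ∷ (Y , j₀ , false) ∷ []) κ j b ≡ c₁ κ j b
      agree X j false _ = ∨-identityʳ _
      agree Y j false _ = ∨-identityʳ _
      agree X j true  _ = refl
      agree Y j true  _ = refl
      agree A j b     _ = refl
      agree Z j b     _ = refl

  cx : ℕ → Indicator
  cx r X j true  = j ≡ᵇ r
  cx r A j false = j ≡ᵇ r
  cx r X j false = j ≡ᵇ suc r
  cx r Y j false = j ≡ᵇ suc r
  cx r _ _ _     = false

  Cx-isIndicator : ∀ i {r} → toℕ i ≡ r → IsIndicator (cx r) (Cx i)
  Cx-isIndicator i refl = isIndicator-cong agree (literals-isIndicator _)
    where
      agree : ∀ κ j b → j < n →
        anyOf ((X , inject₁ i , true) ∷ (A , inject₁ i , false) ∷ (X , fsuc i , false) ∷ (Y , fsuc i , false) ∷ [])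
          κ j b ≡ cx (toℕ i) κ j b
      agree X j true  _ rewrite toℕ-inject₁ i = ∨-identityʳ _
      agree A j false _ rewrite toℕ-inject₁ i = ∨-identityʳ _
      agree X j false _ = ∨-identityʳ _
      agree Y j false _ = ∨-identityʳ _
      agree Y j true  _ = refl
      agree A j true  _ = refl
      agree Z j b     _ = refl

  bā : ℕ → Indicator
  bā r A j false = j ≡ᵇ r
  bā r Z j true  = j ≡ᵇ r
  bā r _ _ _     = false

  Bā-isIndicator : ∀ i {r} → toℕ i ≡ r → IsIndicator (bā r) (Bā i)
  Bā-isIndicator i refl = isIndicator-cong agree (literals-isIndicator _)
    where
      agree : ∀ κ j b → j < n → anyOf ((A , i , false) ∷ (Z , i , true) ∷ []) κ j b ≡ bā (toℕ i) κ j b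
      agree A j false _ = ∨-identityʳ _
      agree Z j true  _ = ∨-identityʳ _
      agree A j true  _ = refl
      agree Z j false _ = refl
      agree X j b     _ = refl
      agree Y j b     _ = refl

  -- The refutation

  -- C₂ₙ once z_0, …, z_{t-1} have been resolved away.
  Cz : ℕ → Indicator
  Cz t X j true  = j ≡ᵇ k
  Cz t A j false = (j ≡ᵇ k) ∨ (j <ᵇ t)
  Cz t Z j false = not (j <ᵇ t)
  Cz t _ _ _     = false

  C₂ₙ-isIndicator : IsIndicator (Cz 0) C₂ₙ
  C₂ₙ-isIndicator =
    isIndicator-cong agree (∷-isIndicator X jₙ true (∷-isIndicator A jₙ false zbar-isIndicator))
    where
      agree : ∀ κ j b → j < n → (single X (toℕ jₙ) true ∪ (single A (toℕ jₙ) false ∪ z̄)) κ j b ≡ Cz 0 κ j b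
      agree X j true  _ rewrite toℕ-fromℕ k = ∨-identityʳ _
      agree A j false _ rewrite toℕ-fromℕ k = refl
      agree Z j false _ = refl
      agree X j false _ = refl
      agree Y j b     _ = refl
      agree A j true  _ = refl
      agree Z j true  _ = refl

  Cz-nonTautological : ∀ t → NonTautological (Cz t)
  Cz-nonTautological t X j _ ()
  Cz-nonTautological t Y j ()
  Cz-nonTautological t A j ()
  Cz-nonTautological t Z j ()

  resolve-z : ∀ {C} t (i : Fin n) → toℕ i ≡ t → IsIndicator (Cz t) C →
    Resolvent prefix (Bā i) C (clause (Cz (suc t)))
  resolve-z t i i≡t isC =
    resolvent Z i i≡t refl (Bā-isIndicator i i≡t) isC (clause-isIndicator (Cz (suc t)))
      (≡ᵇ-refl t) (from T-not (n≮n t ∘ <ᵇ⇒< t t)) agree (Cz-nonTautological (suc t))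
    where
      agree : Cz (suc t) ≐ ((bā t ∖ single Z t true) ∪ (Cz t ∖ single Z t false))
      agree X j true rewrite ∧-identityʳ (j ≡ᵇ k) = refl
      agree A j false rewrite <ᵇ-suc j t with j ≡ᵇ t | j ≡ᵇ k | j <ᵇ t
      ... | true  | true  | _     = refl
      ... | true  | false | _     = refl
      ... | false | true  | _     = refl
      ... | false | false | true  = refl
      ... | false | false | false = refl
      agree Z j false rewrite <ᵇ-suc j t with j ≡ᵇ t | j <ᵇ t
      ... | true  | true  = refl
      ... | true  | false = refl
      ... | false | true  = refl
      ... | false | false = refl
      agree Z j true with j ≡ᵇ t
      ... | true  = refl
      ... | false = refl
      agree X j false = refl
      agree Y j b     = refl
      agree A j true  = refl

  -- With 0-based indices: Lx r = x_r ∨ ā_0 ∨ … ∨ ā_{r-1}, Ly r is its y-twin,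
  -- Lxā r = Lx r ∨ ā_r and Lxāȳ r = Lxā r ∨ ȳ_{r+1}.
  Lx Ly Lxā Lxāȳ : ℕ → Indicator
  Lx r X j true  = j ≡ᵇ r
  Lx r A j false = j <ᵇ r
  Lx r _ _ _     = false

  Ly r Y j true  = j ≡ᵇ r
  Ly r A j false = j <ᵇ r
  Ly r _ _ _     = false

  Lxā r X j true  = j ≡ᵇ r
  Lxā r A j false = j <ᵇ suc r
  Lxā r _ _ _     = false

  Lxāȳ r X j true  = j ≡ᵇ r
  Lxāȳ r A j false = j <ᵇ suc r
  Lxāȳ r Y j false = j ≡ᵇ suc r
  Lxāȳ r _ _ _     = false

  Cz-n-agrees : ∀ κ j b → j < n → Cz n κ j b ≡ Lxā k κ j b
  Cz-n-agrees X j true  _   = refl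
  Cz-n-agrees A j false j<n rewrite <ᵇ-true j<n = ∨-zeroʳ _
  Cz-n-agrees Z j false j<n rewrite <ᵇ-true j<n = refl
  Cz-n-agrees X j false _   = refl
  Cz-n-agrees Y j b     _   = refl
  Cz-n-agrees A j true  _   = refl
  Cz-n-agrees Z j true  _   = refl

  reduce-ā : ∀ {C} r (i : Fin n) → toℕ i ≡ r → IsIndicator (Lxā r) C →
    Reduct prefix C (clause (Lx r))
  reduce-ā r i i≡r isC =
    reduct i i≡r false isC (clause-isIndicator (Lx r)) (<⇒<ᵇ (n<1+n r)) agree (λ ()) precedes
    where
      agree : Lx r ≐ (Lxā r ∖ single A r false)
      agree X j true  = ≡-sym (∧-identityʳ _)
      agree A j false rewrite <ᵇ-suc j r with j ≡ᵇ r in j≡r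
      ... | true  = ≡ᵇ⇒<ᵇ-false j r (from T-≡ j≡r)
      ... | false = ≡-sym (∧-identityʳ _)
      agree X j false = refl
      agree Y j b     = refl
      agree A j true  = refl
      agree Z j b     = refl
      precedes : ∀ κ j b → T (Lx r κ j b) → quantifier κ ≡ ∃q → position κ j < position A r
      precedes X j true j≡r _ rewrite ≡ᵇ⇒≡ j r j≡r = +-monoʳ-< (3 * r) z<s

  Ly-image : ∀ r → clause (Ly r) ≋ map (σ r) (clause (Lx r))
  Ly-image r =
    isIndicator-≋ (clause-isIndicator (Ly r)) (isIndicator-cong agree (map-σ-isIndicator r (clause-isIndicator (Lx r))))
    where
      agree : ∀ κ j b → j < n → swapAt r (Lx r) κ j b ≡ Ly r κ j b
      agree X j true  _ with j ≡ᵇ r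
      ... | true  = refl
      ... | false = refl
      agree Y j true  _ with j ≡ᵇ r
      ... | true  = refl
      ... | false = refl
      agree A j false _ with j ≡ᵇ r in j≡r
      ... | true  = ≡-sym (≡ᵇ⇒<ᵇ-false j r (from T-≡ j≡r))
      ... | false = refl
      agree A j true  _ with j ≡ᵇ r in j≡r
      ... | true  = ≡ᵇ⇒<ᵇ-false j r (from T-≡ j≡r)
      ... | false = refl
      agree X j false _ with j ≡ᵇ r
      ... | true  = refl
      ... | false = refl
      agree Y j false _ with j ≡ᵇ r
      ... | true  = refl
      ... | false = refl
      agree Z j b     _ with j ≡ᵇ r
      ... | true  = refl
      ... | false = refl

  resolve-x : ∀ r (i : Fin k) → toℕ i ≡ r →
    Resolvent prefix (clause (Lx (suc r))) (Cx i) (clause (Lxāȳ r))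
  resolve-x r i i≡r =
    resolvent X (fsuc i) (cong suc i≡r) refl (clause-isIndicator (Lx (suc r))) (Cx-isIndicator i i≡r)
      (clause-isIndicator (Lxāȳ r)) (≡ᵇ-refl r) (≡ᵇ-refl r) agree nonTautological
    where
      agree : Lxāȳ r ≐ ((Lx (suc r) ∖ single X (suc r) true) ∪ (cx r ∖ single X (suc r) false))
      agree X j true with j ≡ᵇ suc r | j ≡ᵇ r
      ... | true  | true  = refl
      ... | true  | false = refl
      ... | false | true  = refl
      ... | false | false = refl
      agree A j false rewrite <ᵇ-suc j r with j ≡ᵇ r | j <ᵇ r
      ... | true  | true  = refl
      ... | true  | false = refl
      ... | false | true  = refl
      ... | false | false = refl
      agree Y j false = ≡-sym (∧-identityʳ _)
      agree X j false with j ≡ᵇ suc r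
      ... | true  = refl
      ... | false = refl
      agree Y j true  = refl
      agree A j true  = refl
      agree Z j b     = refl
      nonTautological : NonTautological (Lxāȳ r)
      nonTautological X j _ ()
      nonTautological Y j ()
      nonTautological A j ()
      nonTautological Z j ()

  resolve-y : ∀ r (i : Fin k) → toℕ i ≡ r →
    Resolvent prefix (clause (Ly (suc r))) (clause (Lxāȳ r)) (clause (Lxā r))
  resolve-y r i i≡r =
    resolvent Y (fsuc i) (cong suc i≡r) refl (clause-isIndicator (Ly (suc r))) (clause-isIndicator (Lxāȳ r))
      (clause-isIndicator (Lxā r)) (≡ᵇ-refl r) (≡ᵇ-refl r) agree nonTautological
    where
      agree : Lxā r ≐ ((Ly (suc r) ∖ single Y (suc r) true) ∪ (Lxāȳ r ∖ single Y (suc r) false))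
      agree X j true  = ≡-sym (∧-identityʳ _)
      agree A j false with j <ᵇ suc r
      ... | true  = refl
      ... | false = refl
      agree Y j true with j ≡ᵇ suc r
      ... | true  = refl
      ... | false = refl
      agree Y j false with j ≡ᵇ suc r
      ... | true  = refl
      ... | false = refl
      agree X j false = refl
      agree A j true  = refl
      agree Z j b     = refl
      nonTautological : NonTautological (Lxā r)
      nonTautological X j _ ()
      nonTautological Y j ()
      nonTautological A j ()
      nonTautological Z j ()

  ȳ₀ : Indicator
  ȳ₀ Y j false = j ≡ᵇ 0
  ȳ₀ _ _ _     = false

  resolve-C₁ : Resolvent prefix (clause (Lx 0)) C₁ (clause ȳ₀)
  resolve-C₁ =
    resolvent X j₀ refl refl (clause-isIndicator (Lx 0)) C₁-isIndicator (clause-isIndicator ȳ₀) _ _ agree nonTautological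
    where
      agree : ȳ₀ ≐ ((Lx 0 ∖ single X 0 true) ∪ (c₁ ∖ single X 0 false))
      agree Y j false = ≡-sym (∧-identityʳ _)
      agree X j true with j ≡ᵇ 0
      ... | true  = refl
      ... | false = refl
      agree X j false with j ≡ᵇ 0
      ... | true  = refl
      ... | false = refl
      agree Y j true  = refl
      agree A j true  = refl
      agree A j false = refl
      agree Z j b     = refl
      nonTautological : NonTautological ȳ₀
      nonTautological Y j ()

  resolve-ȳ₀ : Resolvent prefix (clause (Ly 0)) (clause ȳ₀) []
  resolve-ȳ₀ =
    resolvent Y j₀ refl refl (clause-isIndicator (Ly 0)) (clause-isIndicator ȳ₀) []-isIndicator _ _ agree (λ _ _ ())
    where
      agree : none ≐ ((Ly 0 ∖ single Y 0 true) ∪ (ȳ₀ ∖ single Y 0 false))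
      agree Y j true with j ≡ᵇ 0
      ... | true  = refl
      ... | false = refl
      agree Y j false with j ≡ᵇ 0
      ... | true  = refl
      ... | false = refl
      agree X j b     = refl
      agree A j true  = refl
      agree A j false = refl
      agree Z j b     = refl

  ZStage : ℕ → Set
  ZStage t = ∃ λ Γ → ∃ λ C → Deriv prefix matrix Γ t × C ∈ Γ × IsIndicator (Cz t) C

  zStage : ∀ t → t ≤ n → ZStage t
  zStage zero    _   = C₂ₙ ∷ [] , C₂ₙ , axiom start C₂ₙ∈ , here refl , C₂ₙ-isIndicator
  zStage (suc t) t<n with zStage t (<⇒≤ t<n)
  ... | Γ , C , d , C∈Γ , isC =
    let i = fromℕ< t<n in
    clause (Cz (suc t)) ∷ Bā i ∷ Γ , clause (Cz (suc t)) ,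
    res (axiom d (Bā∈ i)) (here refl) (there C∈Γ) (resolve-z t i (toℕ-fromℕ< t<n) isC) ,
    here refl , clause-isIndicator (Cz (suc t))

  XYStage : ℕ → ℕ → Set
  XYStage r c = ∃ λ Γ → Deriv prefix matrix Γ c × clause (Lx r) ∈ Γ × clause (Ly r) ∈ Γ

  firstXYStage : XYStage k (2 + n)
  firstXYStage with zStage n ≤-refl
  ... | Γ , C , d , C∈Γ , isC =
    clause (Ly k) ∷ clause (Lx k) ∷ Γ ,
    sym (σ k) (red d C∈Γ (reduce-ā k jₙ (toℕ-fromℕ k) (isIndicator-cong Cz-n-agrees isC)))
      (here refl) (σ-symmetry k) (Ly-image k) ,
    there (here refl) , here refl

  nextXYStage : ∀ r → r < k → ∀ {c} → XYStage (suc r) c → XYStage r (4 + c)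
  nextXYStage r r<k (Γ , d , Lx∈ , Ly∈) =
    clause (Ly r) ∷ clause (Lx r) ∷ clause (Lxā r) ∷ clause (Lxāȳ r) ∷ Cx i ∷ Γ ,
    sym (σ r)
      (red (res (res (axiom d (Cx∈ i)) (there Lx∈) (here refl) (resolve-x r i i≡r))
                (there (there Ly∈)) (here refl) (resolve-y r i i≡r))
           (here refl) (reduce-ā r (inject₁ i) (trans (toℕ-inject₁ i) i≡r) (clause-isIndicator (Lxā r))))
      (here refl) (σ-symmetry r) (Ly-image r) ,
    there (here refl) , here refl
    where
      i = fromℕ< r<k
      i≡r = toℕ-fromℕ< r<k

  xyStage : ∀ d r → r + d ≡ k → XYStage r (d * 4 + (2 + n))
  xyStage zero    r r≡k   = subst (λ r → XYStage r (2 + n)) (trans (≡-sym r≡k) (+-identityʳ r)) firstXYStage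
  xyStage (suc d) r r+d≡k =
    nextXYStage r (subst (r <_) r+d≡k (m<m+n r z<s)) (xyStage d (suc r) (trans (≡-sym (+-suc r d)) r+d≡k))

mainTheorem4 : (k : ℕ) → RefutableIn (KBKF.prefix k) (KBKF.matrix k) (5 * suc k)
mainTheorem4 k =
  let (Γ , d , Lx₀∈Γ , Ly₀∈Γ) = xyStage k 0 refl in
  [] ∷ clause ȳ₀ ∷ C₁ ∷ Γ , _ ,
  res (res (axiom d C₁∈) (there Lx₀∈Γ) (here refl) resolve-C₁) (there (there Ly₀∈Γ)) (here refl) resolve-ȳ₀ ,
  here refl , ≤-reflexive (step-count k)
  where
    open KBKF k using (C₁)
    open Refutation k
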